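{- For every nonnegative integer $n$, let $GG_1(n)$ denote the number of partitions of $n$ in which any two consecutive parts differ by at least $2$, and by at least $4$ if both are even. Let $GG'_{ -1}(n)$ denote the number of signed partitions of $n$ in which the positive parts are even and differ pairwise by at least $4$, and the negative parts are odd, distinct and each at most $2\ell^+-1$, where $\ell^+$ is the number of positive parts. Then $GG'_{ -1}(n)=GG_1(n)$ for all $n\ge 0$.
   Context: A partition of an integer $n$ is a finite nonincreasing sequence of positive integers (its parts) summing to $n$. A signed partition of an integer $n$ is a pair $(\pi,\nu)$ of ordinary partitions with $|\pi|-|\nu|=n$, where $|\cdot|$ denotes the sum of parts; the parts of $\pi$ are the positive parts and the parts of $\nu$ are the negative parts (their sizes). $\ell^+$ denotes the number of positive parts of a signed partition. -}

module Defs where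

open import Data.Nat using (ℕ; _+_; _*_; _∸_; _≤_; _<_; _≥_; _%_)
open import Data.Nat.Properties using (_≟_)
open import Data.List using (List; length)
open import Data.Nat.ListAction using (sum)
open import Data.List.Relation.Unary.All using (All)
open import Data.List.Relation.Unary.Linked using (Linked)
open import Data.List.Relation.Unary.AllPairs using (AllPairs)
open import Data.Product using (Σ; _×_)
open import Data.Unit using (⊤)
open import Data.Bool using (Bool; true; false; _∧_)
open import Data.Fin using (Fin)
open import Function.Bundles using (_↔_)
open import Relation.Nullary.Decidable using (⌊_⌋)
open import Relation.Binary.PropositionalEquality using (_≡_)

-- Parity (as propositions; all predicates below are proof-irrelevant,
-- so Σ-types of lists with these properties count lists, not proofs).
Even : ℕ → Set
Even x = x % 2 ≡ 0

Odd : ℕ → Set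
Odd x = x % 2 ≡ 1

even? : ℕ → Bool
even? x = ⌊ x % 2 ≟ 0 ⌋

IsPartition : List ℕ → Set
IsPartition xs = All (λ x → 0 < x) xs × Linked _≥_ xs

IsPartitionOf : ℕ → List ℕ → Set
IsPartitionOf n xs = IsPartition xs × sum xs ≡ n

-- The condition whose value depends on a boolean (avoids function types).
When : Bool → Set → Set
When true  A = A
When false A = ⊤

GGGap : ℕ → ℕ → Set
GGGap x y = (y + 2 ≤ x) × When (even? x ∧ even? y) (y + 4 ≤ x)

GG₁Set : ℕ → Set
GG₁Set n = Σ (List ℕ) λ xs → IsPartitionOf n xs × Linked GGGap xs

-- Signed partitions of n: pairs (π , ν) of partitions with |π| - |ν| = n.
IsSignedPartitionOf : ℕ → List ℕ → List ℕ → Set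
IsSignedPartitionOf n π ν = IsPartition π × IsPartition ν × sum π ≡ n + sum ν

-- Signed partitions counted by GG'_{-1}(n):
-- positive parts even and pairwise differing by at least 4;
-- negative parts odd, distinct (strictly decreasing, as the list is
-- nonincreasing) and each at most 2ℓ⁺ - 1 where ℓ⁺ = length π
-- (for ℓ⁺ = 0 the bound 0 ∸ 1 = 0 excludes all negative parts, as -1 would).
GG'₋₁Set : ℕ → Set
GG'₋₁Set n = Σ (List ℕ) λ π → Σ (List ℕ) λ ν →
  IsSignedPartitionOf n π ν
  × All Even π × AllPairs (λ x y → y + 4 ≤ x) π
  × All Odd ν × AllPairs (λ x y → y < x) ν
  × All (λ x → x ≤ 2 * length π ∸ 1) ν

HasCard : Set → ℕ → Set
HasCard A k = Fin k ↔ A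

{-# OPTIONS --safe #-}

-- Write b(x) ∈ {0, 1} for the parity of x. In a GG₁ partition λ₁ > ⋯ > λ_ℓ the gap
-- condition between consecutive parts reads λᵢ₊₁ + 4 ≤ λᵢ + b(λᵢ) + b(λᵢ₊₁). Hence,
-- with cᵢ the number of odd parts after λᵢ, the parts πᵢ = λᵢ + b(λᵢ) + 2cᵢ are even
-- and differ by at least 4, and |π| − |λ| = Σᵢ (b(λᵢ) + 2cᵢ) is the sum of the odd
-- numbers 2j − 1 ≤ 2ℓ − 1 over the positions j of the odd parts of λ; these are the
-- negative parts. Conversely π and these positions give back λᵢ = πᵢ − bᵢ − 2cᵢ, whose
-- parity is bᵢ because πᵢ is even. The count is finite since GG₁ partitions of n form
-- a decidable subset of the compositions of n.

module Submission where

open import Defs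
open import Data.Bool.Base using (Bool; true; false; not; _∧_; _xor_; T)
open import Data.Bool.Properties using (xor-same; xor-identityʳ; xor-assoc)
open import Data.Fin.Base using (Fin; zero; suc; toℕ; fromℕ<)
open import Data.Fin.Properties using (0↔⊥; 1↔⊤; +↔⊎; toℕ<n; toℕ-fromℕ<; fromℕ<-toℕ)
open import Data.List.Base using (List; []; _∷_; _∷ʳ_; length; map; reverse)
open import Data.List.Properties
  using ( length-map; length-reverse; length-++; reverse-involutive; reverse-map; unfold-reverse
        ; ∷-injectiveˡ; ∷-injectiveʳ )
open import Data.List.Relation.Binary.Permutation.Propositional.Properties using (↭-reverse)
open import Data.List.Relation.Unary.All as All using (All; []; _∷_)
open import Data.List.Relation.Unary.AllPairs as AllPairs using (AllPairs; []; _∷_)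
open import Data.List.Relation.Unary.Linked as Linked using (Linked; []; [-]; _∷_)
open import Data.List.Relation.Unary.Linked.Properties using (AllPairs⇒Linked; Linked⇒AllPairs)
open import Data.Nat.Base
open import Data.Nat.Properties
open import Data.Nat.Induction using (<-rec)
open import Data.Nat.ListAction using (sum)
open import Data.Nat.ListAction.Properties using (sum-↭)
open import Data.Nat.Tactic.RingSolver using (solve-∀)
open import Data.Product.Base using (Σ; _×_; _,_; proj₁; proj₂; uncurry)
open import Data.Product.Function.Dependent.Propositional using (Σ-↔)
open import Data.Sum.Base using (_⊎_; inj₁; inj₂; [_,_])
open import Data.Sum.Function.Propositional using (_⊎-↔_)
open import Data.Unit.Base using (⊤; tt)
open import Function.Base using (_∘_)
open import Function.Bundles using (_↔_; _⇔_; mk↔ₛ′; mk⇔; Equivalence; Inverse)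
open import Function.Properties.Inverse using (↔-refl; ↔-trans)
open import Function.Related.TypeIsomorphisms using (Σ-assoc)
open import Relation.Binary.PropositionalEquality
  using (_≡_; _≢_; refl; sym; trans; cong; cong₂; subst; subst₂; module ≡-Reasoning)
open import Relation.Nullary using (Dec; yes; no; Irrelevant; contradiction)
open import Relation.Nullary.Decidable using (True-↔; _×-dec_)
import Relation.Binary.Definitions as B
import Relation.Unary as U

private variable
  A B : Set

-- Finite types and subtypes

Finite : Set → Set
Finite A = Σ ℕ (HasCard A)

finite-↔ : A ↔ B → Finite A → Finite B
finite-↔ A↔B (k , Fin↔A) = k , ↔-trans Fin↔A A↔B

⊎-finite : Finite A → Finite B → Finite (A ⊎ B)
⊎-finite (k , f) (m , g) = k + m , ↔-trans +↔⊎ (f ⊎-↔ g)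

T-finite : ∀ b → Finite (T b)
T-finite false = 0 , 0↔⊥
T-finite true  = 1 , 1↔⊤

dec-finite : Dec A → Irrelevant A → Finite A
dec-finite a? irr = finite-↔ (True-↔ a? irr) (T-finite _)

Σ-Fin-suc-↔ : ∀ {k} {B : Fin (suc k) → Set} → (B zero ⊎ Σ (Fin k) (B ∘ suc)) ↔ Σ (Fin (suc k)) B
Σ-Fin-suc-↔ = mk↔ₛ′ [ (zero ,_) , (λ (i , b) → suc i , b) ]
  (λ { (zero , b) → inj₁ b ; (suc i , b) → inj₂ (i , b) })
  (λ { (zero , _) → refl ; (suc _ , _) → refl })
  (λ { (inj₁ _) → refl ; (inj₂ _) → refl })

Σ-Fin-finite : ∀ k {B : Fin k → Set} → (∀ i → Finite (B i)) → Finite (Σ (Fin k) B)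
Σ-Fin-finite zero    _     = 0 , mk↔ₛ′ (λ ()) (λ ()) (λ ()) (λ ())
Σ-Fin-finite (suc k) B-fin =
  finite-↔ Σ-Fin-suc-↔ (⊎-finite (B-fin zero) (Σ-Fin-finite k (B-fin ∘ suc)))

Σ-finite : {B : A → Set} → Finite A → (∀ a → Finite (B a)) → Finite (Σ A B)
Σ-finite (k , f) B-fin = finite-↔ (Σ-↔ f ↔-refl) (Σ-Fin-finite k (B-fin ∘ Inverse.to f))

infixr 2 _×-irrelevant_

_×-irrelevant_ : Irrelevant A → Irrelevant B → Irrelevant (A × B)
(irrA ×-irrelevant irrB) (a , b) (a′ , b′) = cong₂ _,_ (irrA a a′) (irrB b b′)

subtype-≡ : {P : A → Set} → U.Irrelevant P → {a b : A} {p : P a} {q : P b} → a ≡ b → (a , p) ≡ (b , q)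
subtype-≡ irr {a} refl = cong (a ,_) (irr {a} _ _)

subtype-↔ : {P : A → Set} {Q : B → Set} → U.Irrelevant P → U.Irrelevant Q →
            (f : A → B) (g : B → A) →
            (∀ a → P a → Q (f a)) → (∀ b → Q b → P (g b)) →
            (∀ b → Q b → f (g b) ≡ b) → (∀ a → P a → g (f a) ≡ a) →
            Σ A P ↔ Σ B Q
subtype-↔ P-irr Q-irr f g f-pres g-pres f∘g g∘f = mk↔ₛ′
  (λ (a , p) → f a , f-pres a p) (λ (b , q) → g b , g-pres b q)
  (λ (b , q) → subtype-≡ Q-irr (f∘g b q)) (λ (a , p) → subtype-≡ P-irr (g∘f a p))

IsPartition-irrelevant : U.Irrelevant IsPartition
IsPartition-irrelevant = All.irrelevant ≤-irrelevant ×-irrelevant Linked.irrelevant ≤-irrelevant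

-- Compositions and the finiteness of GG₁

Composition : ℕ → Set
Composition n = Σ (List ℕ) λ xs → All (0 <_) xs × sum xs ≡ n

Composition-irrelevant : ∀ n → U.Irrelevant (λ xs → All (0 <_) xs × sum xs ≡ n)
Composition-irrelevant n = All.irrelevant ≤-irrelevant ×-irrelevant ≡-irrelevant

composition-zero-unique : (c : Composition 0) → ([] , [] , refl) ≡ c
composition-zero-unique ([]        , []     , refl) = refl
composition-zero-unique (zero  ∷ _ , () ∷ _ , _)
composition-zero-unique (suc _ ∷ _ , _      , ())

composition-suc-↔ : ∀ n → Σ (Fin (suc n)) (λ i → Composition (n ∸ toℕ i)) ↔ Composition (suc n)
composition-suc-↔ n = mk↔ₛ′ cons uncons cons∘uncons uncons∘cons
  where
  cons : Σ (Fin (suc n)) (λ i → Composition (n ∸ toℕ i)) → Composition (suc n)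
  cons (i , xs , pos , s) =
    suc (toℕ i) ∷ xs , z<s ∷ pos , cong suc (trans (cong (toℕ i +_) s) (m+[n∸m]≡n (s≤s⁻¹ (toℕ<n i))))

  uncons : Composition (suc n) → Σ (Fin (suc n)) (λ i → Composition (n ∸ toℕ i))
  uncons (suc x ∷ xs , _ ∷ pos , s) = fromℕ< x<1+n , xs , pos , sum-rest
    where
    x+rest : x + sum xs ≡ n
    x+rest = suc-injective s
    x<1+n : x < suc n
    x<1+n = s≤s (subst (x ≤_) x+rest (m≤m+n x (sum xs)))
    sum-rest : sum xs ≡ n ∸ toℕ (fromℕ< x<1+n)
    sum-rest = trans (sym (m+n∸m≡n x (sum xs))) (cong₂ _∸_ x+rest (sym (toℕ-fromℕ< x<1+n)))

  cons∘uncons : ∀ c → cons (uncons c) ≡ c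
  cons∘uncons (suc x ∷ xs , _ ∷ _ , _) =
    subtype-≡ (Composition-irrelevant (suc n)) (cong (λ k → suc k ∷ xs) (toℕ-fromℕ< _))

  uncons∘cons : ∀ p → uncons (cons p) ≡ p
  uncons∘cons (i , c) = pair-≡ (fromℕ<-toℕ i _) refl
    where
    pair-≡ : ∀ {j} {d : Composition (n ∸ toℕ j)} → j ≡ i → proj₁ d ≡ proj₁ c → (j , d) ≡ (i , c)
    pair-≡ refl eq = cong (i ,_) (subtype-≡ (Composition-irrelevant (n ∸ toℕ i)) eq)

composition-finite : ∀ n → Finite (Composition n)
composition-finite = <-rec (Finite ∘ Composition) λ where
  zero    _   → 1 , mk↔ₛ′ (λ _ → [] , [] , refl) (λ _ → zero)
                          composition-zero-unique (λ { zero → refl })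
  (suc n) rec → finite-↔ (composition-suc-↔ n)
                  (Σ-Fin-finite (suc n) λ i → rec (s≤s (m∸n≤m n (toℕ i))))

When-irrelevant : ∀ b → Irrelevant A → Irrelevant (When b A)
When-irrelevant true  irr = irr
When-irrelevant false _   = λ _ _ → refl

GGGap-irrelevant : B.Irrelevant GGGap
GGGap-irrelevant {x} {y} = ≤-irrelevant ×-irrelevant When-irrelevant (even? x ∧ even? y) ≤-irrelevant

When-dec : ∀ b → Dec A → Dec (When b A)
When-dec true  a? = a?
When-dec false _  = yes tt

GGGap? : B.Decidable GGGap
GGGap? x y = y + 2 ≤? x ×-dec When-dec (even? x ∧ even? y) (y + 4 ≤? x)

GG₁-finite : ∀ n → Finite (GG₁Set n)
GG₁-finite n = finite-↔ reassociate (Σ-finite (composition-finite n) λ (xs , _) →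
  dec-finite (Linked.linked? _≥?_ xs ×-dec Linked.linked? GGGap? xs)
             (Linked.irrelevant ≤-irrelevant ×-irrelevant Linked.irrelevant GGGap-irrelevant))
  where
  reassociate : Σ (Composition n) (λ (xs , _) → Linked _≥_ xs × Linked GGGap xs) ↔ GG₁Set n
  reassociate = mk↔ₛ′ (λ ((xs , pos , s) , ≥s , gaps) → xs , ((pos , ≥s) , s) , gaps)
                      (λ (xs , ((pos , ≥s) , s) , gaps) → (xs , pos , s) , ≥s , gaps)
                      (λ _ → refl) (λ _ → refl)

-- Parity and the gap condition

odd? : ℕ → Bool
odd? x = not (even? x)

bit : Bool → ℕ
bit false = 0
bit true  = 1

odd?-bit : ∀ b → odd? (bit b) ≡ b
odd?-bit false = refl
odd?-bit true  = refl

odd?-suc : ∀ n → odd? (suc n) ≡ not (odd? n)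
odd?-suc zero          = refl
odd?-suc (suc zero)    = refl
odd?-suc (suc (suc n)) = odd?-suc n

odd?-+ : ∀ m n → odd? (m + n) ≡ odd? m xor odd? n
odd?-+ zero          n = refl
odd?-+ (suc zero)    n = odd?-suc n
odd?-+ (suc (suc m)) n = odd?-+ m n

odd?-2* : ∀ n → odd? (2 * n) ≡ false
odd?-2* n = trans (odd?-+ n (n + 0)) (trans (cong (λ m → odd? n xor odd? m) (+-identityʳ n)) (xor-same (odd? n)))

odd?-+2* : ∀ m n → odd? (m + 2 * n) ≡ odd? m
odd?-+2* m n = trans (odd?-+ m (2 * n)) (trans (cong (odd? m xor_) (odd?-2* n)) (xor-identityʳ (odd? m)))

odd?-∸ : ∀ {m n} → n ≤ m → odd? (m ∸ n) ≡ odd? m xor odd? n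
odd?-∸ {m} {n} n≤m = begin
  odd? (m ∸ n)                         ≡⟨ sym (xor-identityʳ _) ⟩
  odd? (m ∸ n) xor false               ≡⟨ cong (odd? (m ∸ n) xor_) (sym (xor-same (odd? n))) ⟩
  odd? (m ∸ n) xor (odd? n xor odd? n) ≡⟨ sym (xor-assoc (odd? (m ∸ n)) _ _) ⟩
  (odd? (m ∸ n) xor odd? n) xor odd? n ≡⟨ cong (_xor odd? n) (sym (odd?-+ (m ∸ n) n)) ⟩
  odd? (m ∸ n + n) xor odd? n          ≡⟨ cong (λ k → odd? k xor odd? n) (m∸n+n≡m n≤m) ⟩
  odd? m xor odd? n                    ∎
  where open ≡-Reasoning

%2≡bit∘odd? : ∀ x → x % 2 ≡ bit (odd? x)
%2≡bit∘odd? zero          = refl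
%2≡bit∘odd? (suc zero)    = refl
%2≡bit∘odd? (suc (suc x)) = %2≡bit∘odd? x

even⇒odd?≡false : ∀ x → Even x → odd? x ≡ false
even⇒odd?≡false _ e rewrite e = refl

odd⇒odd?≡true : ∀ x → Odd x → odd? x ≡ true
odd⇒odd?≡true _ o rewrite o = refl

odd?≡false⇒even : ∀ x → odd? x ≡ false → Even x
odd?≡false⇒even x eq = trans (%2≡bit∘odd? x) (cong bit eq)

odd?≡true⇒odd : ∀ x → odd? x ≡ true → Odd x
odd?≡true⇒odd x eq = trans (%2≡bit∘odd? x) (cong bit eq)

gap-of-different-parity : ∀ {x y} → even? x ≢ even? y → (y + 2 ≤ x × ⊤) ⇔ 2 + (y + 2) ≤ suc x
gap-of-different-parity {x} {y} ne =
  mk⇔ (λ (le , _) → s≤s (≤∧≢⇒< le y+2≢x)) λ le → <⇒≤ (s≤s⁻¹ le) , tt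
  where
  y+2≢x : y + 2 ≢ x
  y+2≢x eq = ne (trans (cong even? (sym eq)) (cong even? (+-comm y 2)))

GGGap⇔ : ∀ x y → GGGap x y ⇔ y + 4 ≤ bit (odd? x) + bit (odd? y) + x
GGGap⇔ x y rewrite +-suc y 3 | +-suc y 2 with even? x in ex | even? y in ey
... | true  | true  = mk⇔ proj₂ λ le → ≤-trans (m≤n+m (y + 2) 2) le , le
... | false | false = mk⇔ (λ (le , _) → s≤s (s≤s le)) λ le → s≤s⁻¹ (s≤s⁻¹ le) , tt
... | false | true  = gap-of-different-parity λ eq → contradiction (trans (trans (sym ex) eq) ey) λ ()
... | true  | false = gap-of-different-parity λ eq → contradiction (trans (trans (sym ex) eq) ey) λ ()

GGGap⇒> : ∀ {x y} → GGGap x y → x > y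
GGGap⇒> {y = y} (y+2≤x , _) = <-≤-trans (m<m+n y z<s) y+2≤x

-- Marks and the odd numbers they select

trues : List Bool → ℕ
trues bs = sum (map bit bs)

trues≤length : ∀ bs → trues bs ≤ length bs
trues≤length []           = z≤n
trues≤length (false ∷ bs) = m≤n⇒m≤1+n (trues≤length bs)
trues≤length (true  ∷ bs) = s≤s (trues≤length bs)

trues-reverse : ∀ bs → trues (reverse bs) ≡ trues bs
trues-reverse bs = trans (cong sum (reverse-map bit bs)) (sum-↭ (↭-reverse (map bit bs)))

-- `odds r` reads the marks from the smallest part to the largest, so a mark on the
-- j-th part counted from the largest selects 2j − 1.
odds : List Bool → List ℕ
odds []          = []
odds (false ∷ r) = odds r
odds (true  ∷ r) = 1 + 2 * length r ∷ odds r

sum-odds-∷ʳ : ∀ r b → sum (odds (r ∷ʳ b)) ≡ bit b + 2 * trues r + sum (odds r)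
sum-odds-∷ʳ []          false = refl
sum-odds-∷ʳ []          true  = refl
sum-odds-∷ʳ (false ∷ r) b     = sum-odds-∷ʳ r b
sum-odds-∷ʳ (true  ∷ r) b     = begin
  1 + 2 * length (r ∷ʳ b) + sum (odds (r ∷ʳ b))
    ≡⟨ cong₂ (λ l s → 1 + 2 * l + s) (length-++ r) (sum-odds-∷ʳ r b) ⟩
  1 + 2 * (length r + 1) + (bit b + 2 * trues r + sum (odds r))
    ≡⟨ rearrange (length r) (bit b) (trues r) (sum (odds r)) ⟩
  bit b + 2 * (1 + trues r) + (1 + 2 * length r + sum (odds r))
    ∎
  where
  open ≡-Reasoning
  rearrange : ∀ l b t s → 1 + 2 * (l + 1) + (b + 2 * t + s) ≡ b + 2 * (1 + t) + (1 + 2 * l + s)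
  rearrange = solve-∀

sum-odds-reverse-∷ : ∀ b bs →
  sum (odds (reverse (b ∷ bs))) ≡ bit b + 2 * trues bs + sum (odds (reverse bs))
sum-odds-reverse-∷ b bs = begin
  sum (odds (reverse (b ∷ bs)))                            ≡⟨ cong (sum ∘ odds) (unfold-reverse b bs) ⟩
  sum (odds (reverse bs ∷ʳ b))                             ≡⟨ sum-odds-∷ʳ (reverse bs) b ⟩
  bit b + 2 * trues (reverse bs) + sum (odds (reverse bs))
    ≡⟨ cong (λ t → bit b + 2 * t + sum (odds (reverse bs))) (trues-reverse bs) ⟩
  bit b + 2 * trues bs + sum (odds (reverse bs))           ∎
  where open ≡-Reasoning

2*-<-suc : ∀ l {x} → x < 2 * l → x < 2 * suc l
2*-<-suc l lt = <-≤-trans lt (*-monoʳ-≤ 2 (n≤1+n l))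

odds-< : ∀ r → All (_< 2 * length r) (odds r)
odds-< []          = []
odds-< (false ∷ r) = All.map (2*-<-suc (length r)) (odds-< r)
odds-< (true  ∷ r) = ≤-reflexive (sym (*-suc 2 (length r))) ∷ All.map (2*-<-suc (length r)) (odds-< r)

odds-positive : ∀ r → All (0 <_) (odds r)
odds-positive []          = []
odds-positive (false ∷ r) = odds-positive r
odds-positive (true  ∷ r) = z<s ∷ odds-positive r

odds-odd : ∀ r → All Odd (odds r)
odds-odd []          = []
odds-odd (false ∷ r) = odds-odd r
odds-odd (true  ∷ r) = odd?≡true⇒odd (1 + 2 * length r) (odd?-+2* 1 (length r)) ∷ odds-odd r

odds-decreasing : ∀ r → AllPairs _>_ (odds r)
odds-decreasing []          = []
odds-decreasing (false ∷ r) = odds-decreasing r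
odds-decreasing (true  ∷ r) = All.map m<n⇒m<1+n (odds-< r) ∷ odds-decreasing r

decode : ℕ → List ℕ → List Bool
decode zero    _       = []
decode (suc l) []      = false ∷ decode l []
decode (suc l) (y ∷ ν) with y ≟ 1 + 2 * l
... | yes _ = true  ∷ decode l ν
... | no  _ = false ∷ decode l (y ∷ ν)

length-decode : ∀ l ν → length (decode l ν) ≡ l
length-decode zero    _       = refl
length-decode (suc l) []      = cong suc (length-decode l [])
length-decode (suc l) (y ∷ ν) with y ≟ 1 + 2 * l
... | yes _ = cong suc (length-decode l ν)
... | no  _ = cong suc (length-decode l (y ∷ ν))

decode-suc-below : ∀ {l ν} → All (_< 2 * l) ν → decode (suc l) ν ≡ false ∷ decode l ν
decode-suc-below           []       = refl
decode-suc-below {l} {y ∷ ν} (y< ∷ _) with y ≟ 1 + 2 * l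
... | yes refl = contradiction (m<n⇒m<1+n y<) (<-irrefl refl)
... | no  _    = refl

decode-odds : ∀ r → decode (length r) (odds r) ≡ r
decode-odds []          = refl
decode-odds (false ∷ r) = trans (decode-suc-below (odds-< r)) (cong (false ∷_) (decode-odds r))
decode-odds (true  ∷ r) with 1 + 2 * length r ≟ 1 + 2 * length r
... | yes _ = cong (true ∷_) (decode-odds r)
... | no ne = contradiction refl ne

odd-<-1+2*⇒<-2* : ∀ l {z} → Odd z → z < 1 + 2 * l → z < 2 * l
odd-<-1+2*⇒<-2* l {z} oz lt = ≤∧≢⇒< (s≤s⁻¹ lt) λ eq →
  contradiction (trans (sym (odd⇒odd?≡true z oz)) (trans (cong odd? eq) (odd?-2* l))) λ ()

odds-decode : ∀ l ν → All Odd ν → AllPairs _>_ ν → All (_< 2 * l) ν → odds (decode l ν) ≡ ν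
odds-decode zero    []      _ _ _        = refl
odds-decode zero    (_ ∷ _) _ _ (() ∷ _)
odds-decode (suc l) []      _ _ _        = odds-decode l [] [] [] []
odds-decode (suc l) (y ∷ ν) (oy ∷ oν) (y>ν ∷ dν) (y< ∷ _) with y ≟ 1 + 2 * l
... | yes refl = cong₂ _∷_ (cong (λ k → 1 + 2 * k) (length-decode l ν))
                   (odds-decode l ν oν dν (All.zipWith (uncurry (odd-<-1+2*⇒<-2* l)) (oν , y>ν)))
... | no  y≢   =
  odds-decode l (y ∷ ν) (oy ∷ oν) (y>ν ∷ dν) (y<2l ∷ All.map (λ z<y → <-trans z<y y<2l) y>ν)
  where
  y<2l : y < 2 * l
  y<2l = odd-<-1+2*⇒<-2* l oy (≤∧≢⇒< (s≤s⁻¹ (subst (y <_) (*-suc 2 l) y<)) y≢)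

-- Shifted partitions

shift : List ℕ → List ℕ
shift []       = []
shift (x ∷ xs) = x + bit (odd? x) + 2 * trues (map odd? xs) ∷ shift xs

unshift : List ℕ → List Bool → List ℕ
unshift (p ∷ π) (b ∷ bs) = p ∸ (bit b + 2 * trues bs) ∷ unshift π bs
unshift _       _        = []

Gap4 : ℕ → ℕ → Set
Gap4 x y = y + 4 ≤ x

Gap4-trans : B.Transitive Gap4
Gap4-trans {k = z} y+4≤x z+4≤y = ≤-trans (≤-trans (m≤m+n (z + 4) 4) (+-monoˡ-≤ 4 z+4≤y)) y+4≤x

Gap4⇒≥ : ∀ {x y} → Gap4 x y → x ≥ y
Gap4⇒≥ {y = y} = ≤-trans (m≤m+n y 4)

EvenSpaced : List ℕ → Set
EvenSpaced π = All (0 <_) π × All Even π × Linked Gap4 π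

EvenSpaced-tail : ∀ {p π} → EvenSpaced (p ∷ π) → EvenSpaced π
EvenSpaced-tail (pos , ev , gaps) = All.tail pos , All.tail ev , Linked.tail gaps

shift-gap⇔ : ∀ x y c →
  GGGap x y ⇔ Gap4 (x + bit (odd? x) + 2 * (bit (odd? y) + c)) (y + bit (odd? y) + 2 * c)
shift-gap⇔ x y c = mk⇔ (to shifted ∘ to (GGGap⇔ x y)) (from (GGGap⇔ x y) ∘ from shifted)
  where
  open Equivalence
  a = bit (odd? x)
  b = bit (odd? y)
  rearrangeˡ : ∀ y b c → y + 4 + (b + 2 * c) ≡ y + b + 2 * c + 4
  rearrangeˡ = solve-∀
  rearrangeʳ : ∀ a b c x → a + b + x + (b + 2 * c) ≡ x + a + 2 * (b + c)
  rearrangeʳ = solve-∀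
  shifted : y + 4 ≤ a + b + x ⇔ Gap4 (x + a + 2 * (b + c)) (y + b + 2 * c)
  shifted = subst₂ (λ u v → y + 4 ≤ a + b + x ⇔ u ≤ v) (rearrangeˡ y b c) (rearrangeʳ a b c x)
              (mk⇔ (+-monoˡ-≤ (b + 2 * c)) (+-cancelʳ-≤ (b + 2 * c) _ _))

shift-linked : ∀ {xs} → Linked GGGap xs → Linked Gap4 (shift xs)
shift-linked []                  = []
shift-linked [-]                 = [-]
shift-linked {x ∷ y ∷ _} (g ∷ gs) = Equivalence.to (shift-gap⇔ x y _) g ∷ shift-linked gs

shift-linked⁻ : ∀ xs → Linked Gap4 (shift xs) → Linked GGGap xs
shift-linked⁻ []           _        = []
shift-linked⁻ (_ ∷ [])     _        = [-]
shift-linked⁻ (x ∷ y ∷ ys) (g ∷ gs) = Equivalence.from (shift-gap⇔ x y _) g ∷ shift-linked⁻ (y ∷ ys) gs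

shift-positive : ∀ {xs} → All (0 <_) xs → All (0 <_) (shift xs)
shift-positive []                 = []
shift-positive {x ∷ _} (x>0 ∷ pos) = ≤-trans x>0 (≤-trans (m≤m+n x _) (m≤m+n _ _)) ∷ shift-positive pos

shift-positive⁻ : ∀ {xs} → Linked GGGap xs → All (0 <_) (shift xs) → All (0 <_) xs
shift-positive⁻ {[]}          _        _        = []
shift-positive⁻ {zero  ∷ []}  _        (() ∷ _)
shift-positive⁻ {suc _ ∷ []}  _        _        = z<s ∷ []
shift-positive⁻ {_ ∷ _ ∷ _}   (g ∷ gs) (_ ∷ pos) = ≤-trans z<s (GGGap⇒> g) ∷ shift-positive⁻ gs pos

shift-even : ∀ xs → All Even (shift xs)
shift-even []       = []
shift-even (x ∷ xs) = odd?≡false⇒even (x + bit (odd? x) + 2 * trues (map odd? xs)) head-parity ∷ shift-even xs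
  where
  head-parity : odd? (x + bit (odd? x) + 2 * trues (map odd? xs)) ≡ false
  head-parity = begin
    odd? (x + bit (odd? x) + 2 * trues (map odd? xs)) ≡⟨ odd?-+2* (x + bit (odd? x)) (trues (map odd? xs)) ⟩
    odd? (x + bit (odd? x))                           ≡⟨ odd?-+ x (bit (odd? x)) ⟩
    odd? x xor odd? (bit (odd? x))                    ≡⟨ cong (odd? x xor_) (odd?-bit (odd? x)) ⟩
    odd? x xor odd? x                                 ≡⟨ xor-same (odd? x) ⟩
    false                                             ∎
    where open ≡-Reasoning

length-shift : ∀ xs → length (shift xs) ≡ length xs
length-shift []       = refl
length-shift (_ ∷ xs) = cong suc (length-shift xs)

sum-shift : ∀ xs → sum (shift xs) ≡ sum xs + sum (odds (reverse (map odd? xs)))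
sum-shift []       = refl
sum-shift (x ∷ xs) = begin
  x + b + 2 * c + sum (shift xs)
    ≡⟨ cong (x + b + 2 * c +_) (sum-shift xs) ⟩
  x + b + 2 * c + (sum xs + sum (odds (reverse (map odd? xs))))
    ≡⟨ rearrange x b (2 * c) (sum xs) _ ⟩
  x + sum xs + (b + 2 * c + sum (odds (reverse (map odd? xs))))
    ≡⟨ cong (x + sum xs +_) (sym (sum-odds-reverse-∷ (odd? x) (map odd? xs))) ⟩
  x + sum xs + sum (odds (reverse (map odd? (x ∷ xs))))
    ∎
  where
  open ≡-Reasoning
  b = bit (odd? x)
  c = trues (map odd? xs)
  rearrange : ∀ x b c s w → x + b + c + (s + w) ≡ x + s + (b + c + w)
  rearrange = solve-∀

EvenSpaced-head : ∀ {p π} → EvenSpaced (p ∷ π) → 1 + 2 * length π ≤ p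
EvenSpaced-head (p>0 ∷ [] , _ , [-]) = p>0
EvenSpaced-head {p} {p′ ∷ π} (p>0 ∷ pos , _ ∷ ev , g ∷ gs) = begin
  1 + 2 * suc (length π)   ≡⟨ cong suc (*-suc 2 (length π)) ⟩
  2 + (1 + 2 * length π)   ≤⟨ +-monoʳ-≤ 2 (EvenSpaced-head (pos , ev , gs)) ⟩
  2 + p′                   ≤⟨ +-monoˡ-≤ p′ (m≤m+n 2 2) ⟩
  4 + p′                   ≡⟨ +-comm 4 p′ ⟩
  p′ + 4                   ≤⟨ g ⟩
  p                        ∎
  where open ≤-Reasoning

unshift-bound : ∀ {p π} b bs → EvenSpaced (p ∷ π) → length bs ≡ length π → bit b + 2 * trues bs ≤ p
unshift-bound b bs sp len = ≤-trans (+-mono-≤ (bit≤1 b) (*-monoʳ-≤ 2 trues≤)) (EvenSpaced-head sp)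
  where
  bit≤1 : ∀ b → bit b ≤ 1
  bit≤1 false = z≤n
  bit≤1 true  = ≤-refl
  trues≤ : trues bs ≤ _
  trues≤ = subst (trues bs ≤_) len (trues≤length bs)

unshift-parities : ∀ π bs → EvenSpaced π → length bs ≡ length π → map odd? (unshift π bs) ≡ bs
unshift-parities []      []       _  _   = refl
unshift-parities (p ∷ π) (b ∷ bs) sp@(_ , p-even ∷ _ , _) len = cong₂ _∷_ head-parity
  (unshift-parities π bs (EvenSpaced-tail sp) (suc-injective len))
  where
  open ≡-Reasoning
  k = bit b + 2 * trues bs
  head-parity : odd? (p ∸ k) ≡ b
  head-parity = begin
    odd? (p ∸ k)         ≡⟨ odd?-∸ (unshift-bound b bs sp (suc-injective len)) ⟩
    odd? p xor odd? k    ≡⟨ cong (_xor odd? k) (even⇒odd?≡false p p-even) ⟩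
    odd? k               ≡⟨ odd?-+2* (bit b) (trues bs) ⟩
    odd? (bit b)         ≡⟨ odd?-bit b ⟩
    b                    ∎

shift-unshift : ∀ π bs → EvenSpaced π → length bs ≡ length π → shift (unshift π bs) ≡ π
shift-unshift []      []       _  _   = refl
shift-unshift (p ∷ π) (b ∷ bs) sp len = cong₂ _∷_ head-shift
  (shift-unshift π bs (EvenSpaced-tail sp) (suc-injective len))
  where
  open ≡-Reasoning
  x = p ∸ (bit b + 2 * trues bs)
  parities = unshift-parities (p ∷ π) (b ∷ bs) sp len
  head-shift : x + bit (odd? x) + 2 * trues (map odd? (unshift π bs)) ≡ p
  head-shift = begin
    x + bit (odd? x) + 2 * trues (map odd? (unshift π bs))
      ≡⟨ cong₂ (λ b′ bs′ → x + bit b′ + 2 * trues bs′) (∷-injectiveˡ parities) (∷-injectiveʳ parities) ⟩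
    x + bit b + 2 * trues bs     ≡⟨ +-assoc x _ _ ⟩
    x + (bit b + 2 * trues bs)   ≡⟨ m∸n+n≡m (unshift-bound b bs sp (suc-injective len)) ⟩
    p                            ∎

unshift-shift : ∀ xs → unshift (shift xs) (map odd? xs) ≡ xs
unshift-shift []       = refl
unshift-shift (x ∷ xs) =
  cong₂ _∷_ (trans (cong (_∸ k) (+-assoc x (bit (odd? x)) c)) (m+n∸n≡m x k)) (unshift-shift xs)
  where
  c = 2 * trues (map odd? xs)
  k = bit (odd? x) + c

Marked : ℕ → List ℕ → List Bool → Set
Marked n π bs = EvenSpaced π × length bs ≡ length π × sum π ≡ n + sum (odds (reverse bs))

Marked-irrelevant : ∀ n π → U.Irrelevant (Marked n π)
Marked-irrelevant n π =
  (All.irrelevant ≤-irrelevant ×-irrelevant All.irrelevant ≡-irrelevant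
                               ×-irrelevant Linked.irrelevant ≤-irrelevant)
  ×-irrelevant ≡-irrelevant ×-irrelevant ≡-irrelevant

GG₁-irrelevant : ∀ n → U.Irrelevant (λ xs → IsPartitionOf n xs × Linked GGGap xs)
GG₁-irrelevant n =
  (IsPartition-irrelevant ×-irrelevant ≡-irrelevant) ×-irrelevant Linked.irrelevant GGGap-irrelevant

GG₁↔Marked : ∀ n → GG₁Set n ↔ Σ (List ℕ × List Bool) (uncurry (Marked n))
GG₁↔Marked n = subtype-↔ (λ {xs} → GG₁-irrelevant n {xs}) (λ {(π , bs)} → Marked-irrelevant n π {bs})
  (λ xs → shift xs , map odd? xs) (uncurry unshift) marked unmarked
  (λ (π , bs) (sp , len , _) → cong₂ _,_ (shift-unshift π bs sp len) (unshift-parities π bs sp len))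
  (λ xs _ → unshift-shift xs)
  where
  marked : ∀ xs → IsPartitionOf n xs × Linked GGGap xs → Marked n (shift xs) (map odd? xs)
  marked xs (((pos , _) , sum≡n) , gaps) =
    (shift-positive pos , shift-even xs , shift-linked gaps) ,
    trans (length-map odd? xs) (sym (length-shift xs)) ,
    trans (sum-shift xs) (cong (_+ sum (odds (reverse (map odd? xs)))) sum≡n)

  unmarked : ∀ ((π , bs) : List ℕ × List Bool) → Marked n π bs →
             IsPartitionOf n (unshift π bs) × Linked GGGap (unshift π bs)
  unmarked (π , bs) (sp@(pos , _ , gaps4) , len , sum≡) =
    ((positive , Linked.map (<⇒≤ ∘ GGGap⇒>) gaps) , sum≡n) , gaps
    where
    open ≡-Reasoning
    xs = unshift π bs
    w = sum (odds (reverse bs))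
    shift≡ : shift xs ≡ π
    shift≡ = shift-unshift π bs sp len
    gaps : Linked GGGap xs
    gaps = shift-linked⁻ xs (subst (Linked Gap4) (sym shift≡) gaps4)
    positive : All (0 <_) xs
    positive = shift-positive⁻ gaps (subst (All (0 <_)) (sym shift≡) pos)
    sum≡n : sum xs ≡ n
    sum≡n = +-cancelʳ-≡ w (sum xs) n (begin
      sum xs + w                                   ≡⟨ cong (λ bs′ → sum xs + sum (odds (reverse bs′)))
                                                           (sym (unshift-parities π bs sp len)) ⟩
      sum xs + sum (odds (reverse (map odd? xs)))  ≡⟨ sym (sum-shift xs) ⟩
      sum (shift xs)                               ≡⟨ cong sum shift≡ ⟩
      sum π                                        ≡⟨ sum≡ ⟩
      n + w                                        ∎)

-- Negative parts

IsGG'₋₁ : ℕ → List ℕ → List ℕ → Set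
IsGG'₋₁ n π ν = IsSignedPartitionOf n π ν
  × All Even π × AllPairs Gap4 π
  × All Odd ν × AllPairs _>_ ν
  × All (λ x → x ≤ 2 * length π ∸ 1) ν

IsGG'₋₁-irrelevant : ∀ n π → U.Irrelevant (IsGG'₋₁ n π)
IsGG'₋₁-irrelevant n π =
  (IsPartition-irrelevant ×-irrelevant IsPartition-irrelevant ×-irrelevant ≡-irrelevant)
  ×-irrelevant All.irrelevant ≡-irrelevant ×-irrelevant AllPairs.irrelevant ≤-irrelevant
  ×-irrelevant All.irrelevant ≡-irrelevant ×-irrelevant AllPairs.irrelevant ≤-irrelevant
  ×-irrelevant All.irrelevant ≤-irrelevant

<⇒≤∸1 : ∀ {x m} → x < m → x ≤ m ∸ 1
<⇒≤∸1 (s≤s x≤m) = x≤m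

≤∸1⇒< : ∀ {x m} → 0 < x → x ≤ m ∸ 1 → x < m
≤∸1⇒< {m = zero}  0<x x≤0 = contradiction x≤0 (<⇒≱ 0<x)
≤∸1⇒< {m = suc m} _   x≤m = s≤s x≤m

marks↔negatives : ∀ n π → Σ (List Bool) (Marked n π) ↔ Σ (List ℕ) (IsGG'₋₁ n π)
marks↔negatives n π =
  subtype-↔ (λ {bs} → Marked-irrelevant n π {bs}) (λ {ν} → IsGG'₋₁-irrelevant n π {ν})
  (odds ∘ reverse) (reverse ∘ decode (length π)) negatives marks odds-reverse-decode decode-odds-reverse
  where
  negatives : ∀ bs → Marked n π bs → IsGG'₋₁ n π (odds (reverse bs))
  negatives bs ((pos , ev , gaps) , len , sum≡) =
    ( (pos , Linked.map Gap4⇒≥ gaps)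
    , (odds-positive r , Linked.map <⇒≤ (AllPairs⇒Linked (odds-decreasing r)))
    , sum≡ ) ,
    ev , Linked⇒AllPairs Gap4-trans gaps , odds-odd r , odds-decreasing r ,
    All.map <⇒≤∸1 (subst (λ l → All (_< 2 * l) (odds r)) (trans (length-reverse bs) len) (odds-< r))
    where r = reverse bs

  odds-reverse-decode : ∀ ν → IsGG'₋₁ n π ν → odds (reverse (reverse (decode (length π) ν))) ≡ ν
  odds-reverse-decode ν ((_ , (ν-pos , _) , _) , _ , _ , ν-odd , ν-dec , ν-bound) =
    trans (cong odds (reverse-involutive (decode (length π) ν)))
          (odds-decode (length π) ν ν-odd ν-dec (All.zipWith (uncurry ≤∸1⇒<) (ν-pos , ν-bound)))

  marks : ∀ ν → IsGG'₋₁ n π ν → Marked n π (reverse (decode (length π) ν))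
  marks ν p@(((pos , _) , _ , sum≡) , ev , gaps , _) =
    (pos , ev , AllPairs⇒Linked gaps) ,
    trans (length-reverse (decode (length π) ν)) (length-decode (length π) ν) ,
    trans sum≡ (cong (λ ν′ → n + sum ν′) (sym (odds-reverse-decode ν p)))

  decode-odds-reverse : ∀ bs → Marked n π bs → reverse (decode (length π) (odds (reverse bs))) ≡ bs
  decode-odds-reverse bs (_ , len , _) = begin
    reverse (decode (length π) (odds (reverse bs)))
      ≡⟨ cong (λ l → reverse (decode l (odds (reverse bs)))) (sym (trans (length-reverse bs) len)) ⟩
    reverse (decode (length (reverse bs)) (odds (reverse bs)))
      ≡⟨ cong reverse (decode-odds (reverse bs)) ⟩
    reverse (reverse bs)
      ≡⟨ reverse-involutive bs ⟩
    bs
      ∎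
    where open ≡-Reasoning

GG₁↔GG'₋₁ : ∀ n → GG₁Set n ↔ GG'₋₁Set n
GG₁↔GG'₋₁ n = ↔-trans (GG₁↔Marked n) (↔-trans Σ-assoc (Σ-↔ ↔-refl (marks↔negatives n _)))

theorem4p2 : (n : ℕ) → Σ ℕ (λ k → HasCard (GG₁Set n) k × HasCard (GG'₋₁Set n) k)
theorem4p2 n = let (k , Fin↔GG₁) = GG₁-finite n in k , Fin↔GG₁ , ↔-trans Fin↔GG₁ (GG₁↔GG'₋₁ n)
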